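{- For all $c,\varepsilon,\tau>0$ with $\varepsilon<\tau\le 8/9$, there exists $\delta>0$ with the following property. Let $G$ be a bigraph with at most $(1-\tau)|V_1(G)|\cdot|V_2(G)|$ edges and with $V_1(G),V_2(G)\neq\emptyset$. Then there exist $Z_i\subseteq V_i(G)$ with $|Z_i|\ge\delta|V_i(G)|$ for $i=1,2$, such that for all subsets $Y_i\subseteq Z_i$ with $|Y_i|\ge c|Z_i|$ for $i=1,2$, there are fewer than $(1-\varepsilon)|Y_1|\cdot|Y_2|$ edges between $Y_1$ and $Y_2$.
   Context: A bigraph $G$ is a finite simple graph with a designated bipartition $(V_1(G),V_2(G))$ of its vertex set, all edges going between the two parts.
   Formalization: The parameters c, ε and τ range over the rationals, and the witness δ is likewise taken in the rationals. -}

module Defs where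

open import Data.Nat using (ℕ)
open import Data.Bool using (Bool; true; false; _∧_; if_then_else_)
open import Data.Fin using (Fin)
open import Data.Fin.Subset using (Subset)
open import Data.List using (map; allFin)
open import Data.Nat.ListAction using (sum)
open import Data.Vec using (lookup)
open import Data.Integer using (+_)
open import Data.Rational using (ℚ; _/_)

record Bigraph : Set where
  field
    n₁ n₂ : ℕ
    adj : Fin n₁ → Fin n₂ → Bool
open Bigraph public

toℚ : ℕ → ℚ
toℚ n = + n / 1

edgesBetween : (G : Bigraph) → Subset (n₁ G) → Subset (n₂ G) → ℕ
edgesBetween G Y₁ Y₂ =
  sum (map (λ i → sum (map (λ j →
    if lookup Y₁ i ∧ lookup Y₂ j ∧ adj G i j then 1 else 0)
    (allFin (n₂ G)))) (allFin (n₁ G)))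

edgeCount : Bigraph → ℕ
edgeCount G =
  sum (map (λ i → sum (map (λ j → if adj G i j then 1 else 0)
    (allFin (n₂ G)))) (allFin (n₁ G)))

{-# OPTIONS --safe #-}
module Submission where

-- Density increment. Let κ = (τ − ε) c², γ = κ / 2, η = min (κ / 8) 1, and call (Z₁ , Z₂) good
-- when it satisfies the conclusion. Start from (V₁ , V₂), of density D ≤ 1 − τ. If (Z₁ , Z₂) is
-- not good, there are Yᵢ ⊆ Zᵢ with |Yᵢ| ≥ c |Zᵢ| and density at least 1 − ε ≥ D + (τ − ε), so
-- Y₁ × Y₂ carries at least κ |Z₁| |Z₂| edges more than density D would allow. Splitting each Zᵢ
-- into Yᵢ and Zᵢ ─ Yᵢ, one of the three remaining blocks must make up for this: it has sides of
-- relative size at least η and density at most D − γ. Densities being nonnegative, after K steps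
-- with K γ ≥ 1 the pair is good, and its sides are at least η ^ K |Vᵢ|; so δ = η ^ K.

open import Defs
open import Data.Nat using (ℕ) renaming (_<_ to _<ℕ_)
open import Data.Product using (Σ; _×_)
open import Data.Fin.Subset using (Subset; _⊆_; ∣_∣)
open import Data.Integer using (+_)
open import Data.Rational using (ℚ; _/_; _<_; _≤_; _*_; _-_; 0ℚ; 1ℚ)

open import Data.Bool using (Bool; true; false; _∧_; if_then_else_)
open import Data.Fin.Subset using (⊤; _─_; inside; outside)
open import Data.Fin.Subset.Properties using (drop-∷-⊆; ∣⊤∣≡n; p⊆q⇒∣p∣≤∣q∣; ∣p─q∣≤∣p∣; anySubset?; _⊆?_)
open import Data.List using ([]; _∷_; map; allFin)
open import Data.List.Properties using (map-cong)
open import Data.Nat.ListAction using (sum)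
open import Data.Vec using ([]; _∷_; lookup; here)
open import Data.Vec.Properties using (lookup-replicate)
open import Data.Fin using (zero; suc)
open import Data.Nat as ℕ using (suc)
import Data.Nat.Properties as ℕ
open import Algebra.Properties.CommutativeSemigroup ℕ.+-commutativeSemigroup using (interchange)
open import Relation.Binary.PropositionalEquality
open import Data.Empty using (⊥; ⊥-elim)
open import Relation.Nullary using (Dec; yes; no)
open import Relation.Nullary.Decidable using (_×-dec_)
open import Data.Product using (_,_; ∃; ∃₂; proj₁; proj₂)
open import Data.Sum using (_⊎_; inj₁; inj₂; [_,_]′)
import Data.Nat.Coprimality as Coprimality
import Data.Integer as ℤ
import Data.Integer.Properties as ℤ
open import Data.Rational using (½; mkℚ; _+_; -_; _⊓_; toℚᵘ; *≤*; *<*; nonNegative; positive; negative)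
open import Data.Rational.Properties
import Data.Rational.Unnormalised as ℚᵘ
import Data.Rational.Unnormalised.Properties as ℚᵘ
open import Data.Rational.Solver using (module +-*-Solver)
open +-*-Solver

indicator : Bool → ℕ
indicator b = if b then 1 else 0

sum-map-+ : ∀ {A : Set} {f g h : A → ℕ} → (∀ x → f x ≡ g x ℕ.+ h x) →
  ∀ xs → sum (map f xs) ≡ sum (map g xs) ℕ.+ sum (map h xs)
sum-map-+ f≡g+h [] = refl
sum-map-+ {g = g} {h} f≡g+h (x ∷ xs) =
  trans (cong₂ ℕ._+_ (f≡g+h x) (sum-map-+ f≡g+h xs))
        (interchange (g x) (h x) (sum (map g xs)) (sum (map h xs)))

∣p∣+∣q─p∣≡∣q∣ : ∀ {n} {p q : Subset n} → p ⊆ q → ∣ p ∣ ℕ.+ ∣ q ─ p ∣ ≡ ∣ q ∣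
∣p∣+∣q─p∣≡∣q∣ {p = []} {[]} _ = refl
∣p∣+∣q─p∣≡∣q∣ {p = inside ∷ p} {y ∷ q} p⊆q with p⊆q here
... | here = cong ℕ.suc (∣p∣+∣q─p∣≡∣q∣ (drop-∷-⊆ p⊆q))
∣p∣+∣q─p∣≡∣q∣ {p = outside ∷ p} {inside ∷ q} p⊆q =
  trans (ℕ.+-suc ∣ p ∣ ∣ q ─ p ∣) (cong ℕ.suc (∣p∣+∣q─p∣≡∣q∣ (drop-∷-⊆ p⊆q)))
∣p∣+∣q─p∣≡∣q∣ {p = outside ∷ p} {outside ∷ q} p⊆q = ∣p∣+∣q─p∣≡∣q∣ (drop-∷-⊆ p⊆q)

indicator-lookup-─ : ∀ {n} {p q : Subset n} → p ⊆ q → ∀ i s →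
  indicator (lookup q i ∧ s) ≡ indicator (lookup p i ∧ s) ℕ.+ indicator (lookup (q ─ p) i ∧ s)
indicator-lookup-─ {p = inside ∷ p} {y ∷ q} p⊆q zero s with p⊆q here
... | here = sym (ℕ.+-identityʳ (indicator s))
indicator-lookup-─ {p = outside ∷ p} {y ∷ q} p⊆q zero s = refl
indicator-lookup-─ {p = x ∷ p} {y ∷ q} p⊆q (suc i) s = indicator-lookup-─ (drop-∷-⊆ p⊆q) i s

indicator-∧-+ : ∀ a {x y z} → indicator x ≡ indicator y ℕ.+ indicator z →
  indicator (a ∧ x) ≡ indicator (a ∧ y) ℕ.+ indicator (a ∧ z)
indicator-∧-+ true  eq = eq
indicator-∧-+ false eq = refl

module _ (G : Bigraph) where

  edgesBetween-─ˡ : ∀ {Y Z} B → Y ⊆ Z →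
    edgesBetween G Z B ≡ edgesBetween G Y B ℕ.+ edgesBetween G (Z ─ Y) B
  edgesBetween-─ˡ B Y⊆Z = sum-map-+ (λ i → sum-map-+ (λ j →
    indicator-lookup-─ Y⊆Z i (lookup B j ∧ adj G i j)) (allFin _)) (allFin _)

  edgesBetween-─ʳ : ∀ A {Y Z} → Y ⊆ Z →
    edgesBetween G A Z ≡ edgesBetween G A Y ℕ.+ edgesBetween G A (Z ─ Y)
  edgesBetween-─ʳ A Y⊆Z = sum-map-+ (λ i → sum-map-+ (λ j →
    indicator-∧-+ (lookup A i) (indicator-lookup-─ Y⊆Z j (adj G i j))) (allFin _)) (allFin _)

  edgeCount≡edgesBetween-⊤ : edgeCount G ≡ edgesBetween G ⊤ ⊤
  edgeCount≡edgesBetween-⊤ = cong sum (map-cong (λ i → cong sum (map-cong (λ j →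
    cong₂ (λ u v → indicator (u ∧ v ∧ adj G i j))
      (sym (lookup-replicate i true)) (sym (lookup-replicate j true))) (allFin _))) (allFin _))

-- toℚ n = + n / 1 only normalises for closed n; this is its normal form.
toℚ≡mkℚ : ∀ n → toℚ n ≡ mkℚ (+ n) 0 (Coprimality.sym (Coprimality.1-coprimeTo n))
toℚ≡mkℚ n = ↥p/↧p≡p (mkℚ (+ n) 0 (Coprimality.sym (Coprimality.1-coprimeTo n)))

toℚ-homo-+ : ∀ m n → toℚ (m ℕ.+ n) ≡ toℚ m + toℚ n
toℚ-homo-+ m n rewrite toℚ≡mkℚ m | toℚ≡mkℚ n =
  /-cong {p₁ = + (m ℕ.+ n)} {p₂ = + m ℤ.* + 1 ℤ.+ + n ℤ.* + 1} {q₂ = 1}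
    (sym (cong₂ ℤ._+_ (ℤ.*-identityʳ (+ m)) (ℤ.*-identityʳ (+ n)))) refl

toℚ-mono-≤ : ∀ {m n} → m ℕ.≤ n → toℚ m ≤ toℚ n
toℚ-mono-≤ {m} {n} m≤n rewrite toℚ≡mkℚ m | toℚ≡mkℚ n =
  *≤* (subst₂ ℤ._≤_ (sym (ℤ.*-identityʳ (+ m))) (sym (ℤ.*-identityʳ (+ n))) (ℤ.+≤+ m≤n))

toℚ-mono-< : ∀ {m n} → m ℕ.< n → toℚ m < toℚ n
toℚ-mono-< {m} {n} m<n rewrite toℚ≡mkℚ m | toℚ≡mkℚ n =
  *<* (subst₂ ℤ._<_ (sym (ℤ.*-identityʳ (+ m))) (sym (ℤ.*-identityʳ (+ n))) (ℤ.+<+ m<n))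

0≤toℚ : ∀ n → 0ℚ ≤ toℚ n
0≤toℚ n = toℚ-mono-≤ {0} {n} ℕ.z≤n

archimedean : ∀ {γ} → 0ℚ < γ → ∃ λ K → 1ℚ ≤ toℚ K * γ
archimedean {γ@(mkℚ (+ suc p) d _)} _ =
  suc d , toℚᵘ-cancel-≤ (ℚᵘ.≤-respʳ-≃ (ℚᵘ.≃-sym (toℚᵘ-homo-* (toℚ (suc d)) γ)) 1≤dγ)
  where
  1≤dγ : toℚᵘ 1ℚ ℚᵘ.≤ toℚᵘ (toℚ (suc d)) ℚᵘ.* toℚᵘ γ
  1≤dγ rewrite toℚ≡mkℚ (suc d) = ℚᵘ.*≤* (subst₂ ℤ._≤_
    (sym (trans (ℤ.*-identityˡ _) (cong +_ (ℕ.*-identityˡ _))))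
    (trans (ℤ.pos-* (suc d) (suc p)) (sym (ℤ.*-identityʳ _)))
    (ℤ.+≤+ (ℕ.m≤m*n (suc d) (suc p))))
archimedean {mkℚ (+ 0) _ _} (*<* (ℤ.+<+ ()))
archimedean {mkℚ ℤ.-[1+ _ ] _ _} (*<* ())

p≤q⇒0≤q-p : ∀ {p q} → p ≤ q → 0ℚ ≤ q - p
p≤q⇒0≤q-p {p} {q} p≤q = subst (_≤ q - p) (+-inverseʳ p) (+-monoˡ-≤ (- p) p≤q)

p<q⇒0<q-p : ∀ {p q} → p < q → 0ℚ < q - p
p<q⇒0<q-p {p} {q} p<q = subst (_< q - p) (+-inverseʳ p) (+-monoˡ-< (- p) p<q)

q-p+p≡q : ∀ p q → q - p + p ≡ q
q-p+p≡q = solve 2 (λ p q → q :- p :+ p := q) refl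

0≤q-p⇒p≤q : ∀ {p q} → 0ℚ ≤ q - p → p ≤ q
0≤q-p⇒p≤q {p} {q} 0≤q-p = subst₂ _≤_ (+-identityˡ p) (q-p+p≡q p q) (+-monoˡ-≤ p 0≤q-p)

0<q-p⇒p<q : ∀ {p q} → 0ℚ < q - p → p < q
0<q-p⇒p<q {p} {q} 0<q-p = subst₂ _<_ (+-identityˡ p) (q-p+p≡q p q) (+-monoˡ-< p 0<q-p)

+-pres-0≤ : ∀ {p q} → 0ℚ ≤ p → 0ℚ ≤ q → 0ℚ ≤ p + q
+-pres-0≤ {p} {q} 0≤p 0≤q = subst (_≤ p + q) (+-identityʳ 0ℚ) (+-mono-≤ 0≤p 0≤q)

*-pres-0≤ : ∀ {p q} → 0ℚ ≤ p → 0ℚ ≤ q → 0ℚ ≤ p * q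
*-pres-0≤ {p} {q} 0≤p 0≤q =
  nonNegative⁻¹ (p * q) {{nonNeg*nonNeg⇒nonNeg p {{nonNegative 0≤p}} q {{nonNegative 0≤q}}}}

*-pres-0< : ∀ {p q} → 0ℚ < p → 0ℚ < q → 0ℚ < p * q
*-pres-0< {p} {q} 0<p 0<q = positive⁻¹ (p * q) {{pos*pos⇒pos p {{positive 0<p}} q {{positive 0<q}}}}

⊓-pres-0< : ∀ {p q} → 0ℚ < p → 0ℚ < q → 0ℚ < p ⊓ q
⊓-pres-0< {p} {q} 0<p 0<q =
  [ (λ p⊓q≡p → subst (0ℚ <_) (sym p⊓q≡p) 0<p) , (λ p⊓q≡q → subst (0ℚ <_) (sym p⊓q≡q) 0<q) ]′
    (⊓-sel p q)

*-mono-≤-nonNeg : ∀ {p q x y} → 0ℚ ≤ p → p ≤ q → 0ℚ ≤ x → x ≤ y → p * x ≤ q * y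
*-mono-≤-nonNeg {q = q} 0≤p p≤q 0≤x x≤y = ≤-trans
  (*-monoʳ-≤-nonNeg _ {{nonNegative 0≤x}} p≤q)
  (*-monoˡ-≤-nonNeg q {{nonNegative (≤-trans 0≤p p≤q)}} x≤y)

nonNeg+pos≢0 : ∀ {p q} → 0ℚ ≤ p → 0ℚ < q → p + q ≢ 0ℚ
nonNeg+pos≢0 0≤p 0<q p+q≡0 = <-irrefl refl (subst₂ _<_ (+-identityʳ 0ℚ) p+q≡0 (+-mono-≤-< 0≤p 0<q))

p-q≤p : ∀ {p q} → 0ℚ ≤ q → p - q ≤ p
p-q≤p {p} {q} 0≤q = 0≤q-p⇒p≤q (subst (0ℚ ≤_) (solve 2 (λ p q → q := p :- (p :- q)) refl p q) 0≤q)

p-q<p : ∀ {p q} → 0ℚ < q → p - q < p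
p-q<p {p} {q} 0<q = 0<q-p⇒p<q (subst (0ℚ <_) (solve 2 (λ p q → q := p :- (p :- q)) refl p q) 0<q)

d≤1⇒d*x*y≤e+m : ∀ {d x y e m} → d ≤ 1ℚ → 0ℚ ≤ x * y → 0ℚ ≤ e → x * y ≤ m → d * x * y ≤ e + m
d≤1⇒d*x*y≤e+m {d} {x} {y} {e} {m} d≤1 0≤xy 0≤e xy≤m = begin
  d * x * y    ≡⟨ *-assoc d x y ⟩
  d * (x * y)  ≤⟨ *-monoʳ-≤-nonNeg (x * y) {{nonNegative 0≤xy}} d≤1 ⟩
  1ℚ * (x * y) ≡⟨ *-identityˡ (x * y) ⟩
  x * y        ≤⟨ xy≤m ⟩
  m            ≤⟨ subst (_≤ e + m) (+-identityˡ m) (+-monoˡ-≤ m 0≤e) ⟩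
  e + m        ∎
  where open ≤-Reasoning

≤-trans-scaled : ∀ {p q x y z} → 0ℚ ≤ p → q * x ≤ y → p * y ≤ z → p * q * x ≤ z
≤-trans-scaled {p} {q} {x} 0≤p qx≤y py≤z = ≤-trans
  (≤-trans (≤-reflexive (*-assoc p q x)) (*-monoˡ-≤-nonNeg p {{nonNegative 0≤p}} qx≤y)) py≤z

0≤e≤D*x*y⇒0≤D : ∀ {D x y e} → 0ℚ < x → 0ℚ < y → 0ℚ ≤ e → e ≤ D * x * y → 0ℚ ≤ D
0≤e≤D*x*y⇒0≤D {D} {x} {y} 0<x 0<y 0≤e e≤Dxy = ≮⇒≥ λ D<0 → <-irrefl refl
  (≤-<-trans (≤-trans 0≤e e≤Dxy) (negative⁻¹ (D * x * y)
    {{neg*pos⇒neg (D * x) {{neg*pos⇒neg D {{negative D<0}} x {{positive 0<x}}}} y {{positive 0<y}}}}))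

p<[1+k]q⇒p-q<kq : ∀ k {p q} → p < toℚ (suc k) * q → p - q < toℚ k * q
p<[1+k]q⇒p-q<kq k {p} {q} p<[1+k]q = 0<q-p⇒p<q (subst (0ℚ <_)
  (solve 3 (λ k p q → (con 1ℚ :+ k) :* q :- p := k :* q :- (p :- q)) refl (toℚ k) p q)
  (p<q⇒0<q-p (subst (λ k → p < k * q) (toℚ-homo-+ 1 k) p<[1+k]q)))

infixr 8 _^_
_^_ : ℚ → ℕ → ℚ
p ^ 0     = 1ℚ
p ^ suc n = p ^ n * p

^-pres-0< : ∀ {p} → 0ℚ < p → ∀ n → 0ℚ < p ^ n
^-pres-0< 0<p 0       = positive⁻¹ 1ℚ
^-pres-0< 0<p (suc n) = *-pres-0< (^-pres-0< 0<p n) 0<p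

^-≤1 : ∀ {p} → 0ℚ < p → p ≤ 1ℚ → ∀ n → p ^ n ≤ 1ℚ
^-≤1 0<p p≤1 0       = ≤-refl
^-≤1 0<p p≤1 (suc n) = ≤-trans
  (*-mono-≤-nonNeg (<⇒≤ (^-pres-0< 0<p n)) (^-≤1 0<p p≤1 n) (<⇒≤ 0<p) p≤1)
  (≤-reflexive (*-identityˡ 1ℚ))

p^n*q≤q : ∀ {p q} → 0ℚ < p → p ≤ 1ℚ → 0ℚ ≤ q → ∀ n → p ^ n * q ≤ q
p^n*q≤q {q = q} 0<p p≤1 0≤q n = ≤-trans (*-monoʳ-≤-nonNeg q {{nonNegative 0≤q}} (^-≤1 0<p p≤1 n))
  (≤-reflexive (*-identityˡ q))

⅛ : ℚ
⅛ = + 1 / 8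

¬three-dense-blocks : ∀ {N₁ N₂ a a' b b' e₁₁ e₁₂ e₂₁ e₂₂ D μ κ η : ℚ} →
  N₁ ≡ a + a' → N₂ ≡ b + b' → 0ℚ < κ → 0ℚ < N₁ * N₂ → η ≤ κ * ⅛ → 0ℚ ≤ a * b →
  κ * (N₁ * N₂) ≤ (μ - D) * (a * b) →
  (e₁₁ + e₁₂) + (e₂₁ + e₂₂) ≤ D * N₁ * N₂ →
  μ * a * b ≤ e₁₁ →
  (D - κ * ½) * a * b' ≤ e₁₂ + η * N₁ * N₂ →
  (D - κ * ½) * a' * b ≤ e₂₁ + η * N₁ * N₂ →
  (D - κ * ½) * a' * b' ≤ e₂₂ + η * N₁ * N₂ → ⊥
¬three-dense-blocks {a = a} {a'} {b} {b'} {e₁₁} {e₁₂} {e₂₁} {e₂₂} {D} {μ} {κ} {η}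
  refl refl 0<κ 0<N η≤κ⅛ 0≤ab gap total dense₁₁ dense₁₂ dense₂₁ dense₂₂ =
  nonNeg+pos≢0
    (+-pres-0≤ (+-pres-0≤ (+-pres-0≤ (+-pres-0≤ (+-pres-0≤ (+-pres-0≤ (+-pres-0≤ (+-pres-0≤
      (p≤q⇒0≤q-p total) (p≤q⇒0≤q-p dense₁₁)) (p≤q⇒0≤q-p dense₁₂)) (p≤q⇒0≤q-p dense₂₁))
      (p≤q⇒0≤q-p dense₂₂)) (p≤q⇒0≤q-p gap)) (*-pres-0≤ (*-pres-0≤ (<⇒≤ 0<κ) (<⇒≤ (positive⁻¹ ½))) 0≤ab))
      η-slack) (+-pres-0≤ η-slack η-slack))
    (*-pres-0< (*-pres-0< 0<κ 0<N) (positive⁻¹ ⅛))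
    (slacks-cancel a a' b b' e₁₁ e₁₂ e₂₁ e₂₂ D μ κ η)
  where
  η-slack : 0ℚ ≤ (κ * ⅛ - η) * ((a + a') * (b + b'))
  η-slack = *-pres-0≤ (p≤q⇒0≤q-p η≤κ⅛) (<⇒≤ 0<N)
  -- The slacks of the hypotheses, that of η ≤ κ/8 taken thrice, add up to −κ N₁ N₂ / 8.
  slacks-cancel : ∀ a a' b b' e₁₁ e₁₂ e₂₁ e₂₂ D μ κ η →
    let N₁ = a + a' ; N₂ = b + b' ; γ = κ * ½ in
    (D * N₁ * N₂ - ((e₁₁ + e₁₂) + (e₂₁ + e₂₂))) + (e₁₁ - μ * a * b)
    + (e₁₂ + η * N₁ * N₂ - (D - γ) * a * b') + (e₂₁ + η * N₁ * N₂ - (D - γ) * a' * b)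
    + (e₂₂ + η * N₁ * N₂ - (D - γ) * a' * b') + ((μ - D) * (a * b) - κ * (N₁ * N₂))
    + γ * (a * b) + (κ * ⅛ - η) * (N₁ * N₂)
    + ((κ * ⅛ - η) * (N₁ * N₂) + (κ * ⅛ - η) * (N₁ * N₂))
    + κ * (N₁ * N₂) * ⅛ ≡ 0ℚ
  slacks-cancel = solve 12 (λ a a' b b' e₁₁ e₁₂ e₂₁ e₂₂ D μ κ η →
    let N₁ = a :+ a' ; N₂ = b :+ b' ; γ = κ :* con ½ in
    (D :* N₁ :* N₂ :- ((e₁₁ :+ e₁₂) :+ (e₂₁ :+ e₂₂))) :+ (e₁₁ :- μ :* a :* b)
    :+ (e₁₂ :+ η :* N₁ :* N₂ :- (D :- γ) :* a :* b') :+ (e₂₁ :+ η :* N₁ :* N₂ :- (D :- γ) :* a' :* b)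
    :+ (e₂₂ :+ η :* N₁ :* N₂ :- (D :- γ) :* a' :* b') :+ ((μ :- D) :* (a :* b) :- κ :* (N₁ :* N₂))
    :+ γ :* (a :* b) :+ (κ :* con ⅛ :- η) :* (N₁ :* N₂)
    :+ ((κ :* con ⅛ :- η) :* (N₁ :* N₂) :+ (κ :* con ⅛ :- η) :* (N₁ :* N₂))
    :+ κ :* (N₁ :* N₂) :* con ⅛ := con 0ℚ) refl

size : ∀ {n} → Subset n → ℚ
size Z = toℚ ∣ Z ∣

0≤size : ∀ {n} (Z : Subset n) → 0ℚ ≤ size Z
0≤size Z = 0≤toℚ ∣ Z ∣

0≤size*size : ∀ {n m} (X : Subset n) (Y : Subset m) → 0ℚ ≤ size X * size Y
0≤size*size X Y = *-pres-0≤ (0≤size X) (0≤size Y)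

size-⊤ : ∀ n → size (⊤ {n}) ≡ toℚ n
size-⊤ n = cong toℚ (∣⊤∣≡n n)

size-mono : ∀ {n} {Y Z : Subset n} → Y ⊆ Z → size Y ≤ size Z
size-mono {Y = Y} {Z} Y⊆Z = toℚ-mono-≤ {∣ Y ∣} {∣ Z ∣} (p⊆q⇒∣p∣≤∣q∣ Y⊆Z)

size-─≤ : ∀ {n} (Z Y : Subset n) → size (Z ─ Y) ≤ size Z
size-─≤ Z Y = toℚ-mono-≤ {∣ Z ─ Y ∣} {∣ Z ∣} (∣p─q∣≤∣p∣ Z Y)

size-─ : ∀ {n} {Y Z : Subset n} → Y ⊆ Z → size Z ≡ size Y + size (Z ─ Y)
size-─ {Y = Y} {Z} Y⊆Z = trans (cong toℚ (sym (∣p∣+∣q─p∣≡∣q∣ Y⊆Z))) (toℚ-homo-+ ∣ Y ∣ ∣ Z ─ Y ∣)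

module DensityIncrement (c ε τ : ℚ) (0<c : 0ℚ < c) (ε<τ : ε < τ) (0<τ : 0ℚ < τ) where

  -- γ + 3η ≤ 7κ/8 < κ is what ¬three-dense-blocks needs; η ≤ 1 keeps η ^ k ≤ 1.
  κ γ η : ℚ
  κ = (τ - ε) * c * c
  γ = κ * ½
  η = κ * ⅛ ⊓ 1ℚ

  0<κ : 0ℚ < κ
  0<κ = *-pres-0< (*-pres-0< (p<q⇒0<q-p ε<τ) 0<c) 0<c

  0<γ : 0ℚ < γ
  0<γ = *-pres-0< 0<κ (positive⁻¹ ½)

  0<η : 0ℚ < η
  0<η = ⊓-pres-0< (*-pres-0< 0<κ (positive⁻¹ ⅛)) (positive⁻¹ 1ℚ)

  η≤κ⅛ : η ≤ κ * ⅛
  η≤κ⅛ = p⊓q≤p (κ * ⅛) 1ℚ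

  η≤1 : η ≤ 1ℚ
  η≤1 = p⊓q≤q (κ * ⅛) 1ℚ

  module _ (G : Bigraph) where

    edges : Subset (n₁ G) → Subset (n₂ G) → ℚ
    edges X₁ X₂ = toℚ (edgesBetween G X₁ X₂)

    Good : Subset (n₁ G) → Subset (n₂ G) → Set
    Good Z₁ Z₂ = (Y₁ : Subset (n₁ G)) (Y₂ : Subset (n₂ G)) → Y₁ ⊆ Z₁ → Y₂ ⊆ Z₂ →
      c * size Z₁ ≤ size Y₁ → c * size Z₂ ≤ size Y₂ → edges Y₁ Y₂ < (1ℚ - ε) * size Y₁ * size Y₂

    Dense : Subset (n₁ G) → Subset (n₂ G) → Subset (n₁ G) → Subset (n₂ G) → Set
    Dense Z₁ Z₂ Y₁ Y₂ = Y₁ ⊆ Z₁ × Y₂ ⊆ Z₂ × c * size Z₁ ≤ size Y₁ × c * size Z₂ ≤ size Y₂ ×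
      (1ℚ - ε) * size Y₁ * size Y₂ ≤ edges Y₁ Y₂

    dense? : ∀ Z₁ Z₂ → Dec (∃₂ (Dense Z₁ Z₂))
    dense? Z₁ Z₂ =
      anySubset? {P = λ Y₁ → ∃ (Dense Z₁ Z₂ Y₁)} λ Y₁ → anySubset? {P = Dense Z₁ Z₂ Y₁} λ Y₂ →
      (Y₁ ⊆? Z₁) ×-dec (Y₂ ⊆? Z₂) ×-dec (c * size Z₁ ≤? size Y₁) ×-dec (c * size Z₂ ≤? size Y₂)
        ×-dec ((1ℚ - ε) * size Y₁ * size Y₂ ≤? edges Y₁ Y₂)

    good-or-dense : ∀ Z₁ Z₂ → Good Z₁ Z₂ ⊎ ∃₂ (Dense Z₁ Z₂)
    good-or-dense Z₁ Z₂ = from-dec (dense? Z₁ Z₂)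
      where
      from-dec : Dec (∃₂ (Dense Z₁ Z₂)) → Good Z₁ Z₂ ⊎ ∃₂ (Dense Z₁ Z₂)
      from-dec (yes dense) = inj₂ dense
      from-dec (no ¬dense) = inj₁ λ Y₁ Y₂ Y₁⊆Z₁ Y₂⊆Z₂ cZ₁≤Y₁ cZ₂≤Y₂ →
        ≰⇒> λ full → ¬dense (Y₁ , Y₂ , Y₁⊆Z₁ , Y₂⊆Z₂ , cZ₁≤Y₁ , cZ₂≤Y₂ , full)

    Increment : Subset (n₁ G) → Subset (n₂ G) → ℚ → Subset (n₁ G) → Subset (n₂ G) → Set
    Increment Z₁ Z₂ D X₁ X₂ = η * size Z₁ ≤ size X₁ × η * size Z₂ ≤ size X₂ ×
      edges X₁ X₂ ≤ (D - γ) * size X₁ * size X₂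

    NearlyDense : Subset (n₁ G) → Subset (n₂ G) → ℚ → Subset (n₁ G) → Subset (n₂ G) → Set
    NearlyDense Z₁ Z₂ D X₁ X₂ = (D - γ) * size X₁ * size X₂ ≤ edges X₁ X₂ + η * size Z₁ * size Z₂

    increment-or-nearlyDense : ∀ {Z₁ Z₂ X₁ X₂} D → D - γ ≤ 1ℚ →
      size X₁ ≤ size Z₁ → size X₂ ≤ size Z₂ →
      Increment Z₁ Z₂ D X₁ X₂ ⊎ NearlyDense Z₁ Z₂ D X₁ X₂
    increment-or-nearlyDense {Z₁} {Z₂} {X₁} {X₂} D D-γ≤1 X₁≤Z₁ X₂≤Z₂ = decide
      (η * size Z₁ ≤? size X₁) (η * size Z₂ ≤? size X₂) (edges X₁ X₂ ≤? (D - γ) * size X₁ * size X₂)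
      where
      small-block : size X₁ * size X₂ ≤ η * size Z₁ * size Z₂ → NearlyDense Z₁ Z₂ D X₁ X₂
      small-block = d≤1⇒d*x*y≤e+m D-γ≤1 (0≤size*size X₁ X₂) (0≤toℚ (edgesBetween G X₁ X₂))
      decide : Dec (η * size Z₁ ≤ size X₁) → Dec (η * size Z₂ ≤ size X₂) →
        Dec (edges X₁ X₂ ≤ (D - γ) * size X₁ * size X₂) →
        Increment Z₁ Z₂ D X₁ X₂ ⊎ NearlyDense Z₁ Z₂ D X₁ X₂
      decide (yes large₁) (yes large₂) (yes sparse) = inj₁ (large₁ , large₂ , sparse)
      decide (yes _) (yes _) (no ¬sparse) = inj₂ (<⇒≤ (<-≤-trans (≰⇒> ¬sparse)
        (subst (_≤ edges X₁ X₂ + η * size Z₁ * size Z₂) (+-identityʳ (edges X₁ X₂))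
          (+-monoʳ-≤ (edges X₁ X₂) (*-pres-0≤ (*-pres-0≤ (<⇒≤ 0<η) (0≤size Z₁)) (0≤size Z₂))))))
      decide (no small₁) _ _ = inj₂ (small-block
        (*-mono-≤-nonNeg (0≤size X₁) (<⇒≤ (≰⇒> small₁)) (0≤size X₂) X₂≤Z₂))
      decide (yes _) (no small₂) _ = inj₂ (small-block (≤-trans
        (*-mono-≤-nonNeg (0≤size X₁) X₁≤Z₁ (0≤size X₂) (<⇒≤ (≰⇒> small₂)))
        (≤-reflexive (solve 3 (λ N₁ N₂ η → N₁ :* (η :* N₂) := η :* N₁ :* N₂)
          refl (size Z₁) (size Z₂) η))))

    edges-─ : ∀ {Y₁ Z₁ Y₂ Z₂} → Y₁ ⊆ Z₁ → Y₂ ⊆ Z₂ → edges Z₁ Z₂ ≡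
      (edges Y₁ Y₂ + edges Y₁ (Z₂ ─ Y₂)) + (edges (Z₁ ─ Y₁) Y₂ + edges (Z₁ ─ Y₁) (Z₂ ─ Y₂))
    edges-─ {Y₁} {Z₁} {Y₂} {Z₂} Y₁⊆Z₁ Y₂⊆Z₂ = begin
      edges Z₁ Z₂
        ≡⟨ cong toℚ (edgesBetween-─ˡ G Z₂ Y₁⊆Z₁) ⟩
      toℚ (edgesBetween G Y₁ Z₂ ℕ.+ edgesBetween G (Z₁ ─ Y₁) Z₂)
        ≡⟨ toℚ-homo-+ (edgesBetween G Y₁ Z₂) (edgesBetween G (Z₁ ─ Y₁) Z₂) ⟩
      edges Y₁ Z₂ + edges (Z₁ ─ Y₁) Z₂
        ≡⟨ cong₂ _+_ (edges-─ʳ Y₁) (edges-─ʳ (Z₁ ─ Y₁)) ⟩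
      (edges Y₁ Y₂ + edges Y₁ (Z₂ ─ Y₂)) + (edges (Z₁ ─ Y₁) Y₂ + edges (Z₁ ─ Y₁) (Z₂ ─ Y₂)) ∎
      where
      open ≡-Reasoning
      edges-─ʳ : ∀ X → edges X Z₂ ≡ edges X Y₂ + edges X (Z₂ ─ Y₂)
      edges-─ʳ X = trans (cong toℚ (edgesBetween-─ʳ G X Y₂⊆Z₂))
        (toℚ-homo-+ (edgesBetween G X Y₂) (edgesBetween G X (Z₂ ─ Y₂)))

    density-increment : ∀ {Z₁ Z₂ Y₁ Y₂ D} → 0ℚ < size Z₁ → 0ℚ < size Z₂ → D ≤ 1ℚ - τ →
      edges Z₁ Z₂ ≤ D * size Z₁ * size Z₂ → Dense Z₁ Z₂ Y₁ Y₂ → ∃₂ (Increment Z₁ Z₂ D)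
    density-increment {Z₁} {Z₂} {Y₁} {Y₂} {D} 0<Z₁ 0<Z₂ D≤1-τ sparse
      (Y₁⊆Z₁ , Y₂⊆Z₂ , cZ₁≤Y₁ , cZ₂≤Y₂ , dense) =
      pick (block Y₁ Y₂' (size-mono Y₁⊆Z₁) (size-─≤ Z₂ Y₂))
           (block Y₁' Y₂ (size-─≤ Z₁ Y₁) (size-mono Y₂⊆Z₂))
           (block Y₁' Y₂' (size-─≤ Z₁ Y₁) (size-─≤ Z₂ Y₂))
      where
      Y₁' : Subset (n₁ G)
      Y₁' = Z₁ ─ Y₁
      Y₂' : Subset (n₂ G)
      Y₂' = Z₂ ─ Y₂
      Outcome : Subset (n₁ G) → Subset (n₂ G) → Set
      Outcome X₁ X₂ = Increment Z₁ Z₂ D X₁ X₂ ⊎ NearlyDense Z₁ Z₂ D X₁ X₂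
      block : ∀ X₁ X₂ → size X₁ ≤ size Z₁ → size X₂ ≤ size Z₂ → Outcome X₁ X₂
      block X₁ X₂ = increment-or-nearlyDense {Z₁} {Z₂} {X₁} {X₂} D
        (≤-trans (p-q≤p (<⇒≤ 0<γ)) (≤-trans D≤1-τ (p-q≤p (<⇒≤ 0<τ))))
      gap : κ * (size Z₁ * size Z₂) ≤ ((1ℚ - ε) - D) * (size Y₁ * size Y₂)
      gap = begin
        κ * (size Z₁ * size Z₂)
          ≡⟨ solve 4 (λ t c N₁ N₂ → t :* c :* c :* (N₁ :* N₂) := t :* (c :* N₁ :* (c :* N₂)))
               refl (τ - ε) c (size Z₁) (size Z₂) ⟩
        (τ - ε) * (c * size Z₁ * (c * size Z₂))
          ≤⟨ *-mono-≤-nonNeg (<⇒≤ (p<q⇒0<q-p ε<τ)) τ-ε≤1-ε-D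
               (*-pres-0≤ 0≤cZ₁ 0≤cZ₂) (*-mono-≤-nonNeg 0≤cZ₁ cZ₁≤Y₁ 0≤cZ₂ cZ₂≤Y₂) ⟩
        ((1ℚ - ε) - D) * (size Y₁ * size Y₂) ∎
        where
        open ≤-Reasoning
        0≤cZ₁ : 0ℚ ≤ c * size Z₁
        0≤cZ₁ = *-pres-0≤ (<⇒≤ 0<c) (0≤size Z₁)
        0≤cZ₂ : 0ℚ ≤ c * size Z₂
        0≤cZ₂ = *-pres-0≤ (<⇒≤ 0<c) (0≤size Z₂)
        τ-ε≤1-ε-D : τ - ε ≤ (1ℚ - ε) - D
        τ-ε≤1-ε-D = 0≤q-p⇒p≤q (subst (0ℚ ≤_)
          (solve 3 (λ D ε τ → con 1ℚ :- τ :- D := (con 1ℚ :- ε) :- D :- (τ :- ε)) refl D ε τ)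
          (p≤q⇒0≤q-p D≤1-τ))
      pick : Outcome Y₁ Y₂' → Outcome Y₁' Y₂ → Outcome Y₁' Y₂' → ∃₂ (Increment Z₁ Z₂ D)
      pick (inj₁ inc) _ _ = Y₁ , Y₂' , inc
      pick (inj₂ _) (inj₁ inc) _ = Y₁' , Y₂ , inc
      pick (inj₂ _) (inj₂ _) (inj₁ inc) = Y₁' , Y₂' , inc
      pick (inj₂ nearlyDense₁₂) (inj₂ nearlyDense₂₁) (inj₂ nearlyDense₂₂) =
        ⊥-elim (¬three-dense-blocks
          {size Z₁} {size Z₂} {size Y₁} {size Y₁'} {size Y₂} {size Y₂'}
          {edges Y₁ Y₂} {edges Y₁ Y₂'} {edges Y₁' Y₂} {edges Y₁' Y₂'} {D} {1ℚ - ε} {κ} {η}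
          (size-─ Y₁⊆Z₁) (size-─ Y₂⊆Z₂) 0<κ (*-pres-0< 0<Z₁ 0<Z₂)
          η≤κ⅛ (0≤size*size Y₁ Y₂) gap
          (subst (_≤ D * size Z₁ * size Z₂) (edges-─ Y₁⊆Z₁ Y₂⊆Z₂) sparse)
          dense nearlyDense₁₂ nearlyDense₂₁ nearlyDense₂₂)

    LargeGoodPair : ℕ → ℚ → ℚ → Set
    LargeGoodPair k N₁ N₂ = Σ (Subset (n₁ G)) λ W₁ → Σ (Subset (n₂ G)) λ W₂ →
      η ^ k * N₁ ≤ size W₁ × η ^ k * N₂ ≤ size W₂ × Good W₁ W₂

    sparse⇒largeGoodPair : ∀ k {Z₁ Z₂ D} → 0ℚ < size Z₁ → 0ℚ < size Z₂ → D ≤ 1ℚ - τ → D < toℚ k * γ →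
      edges Z₁ Z₂ ≤ D * size Z₁ * size Z₂ → LargeGoodPair k (size Z₁) (size Z₂)
    sparse⇒largeGoodPair 0 {Z₁} {Z₂} {D} 0<Z₁ 0<Z₂ _ D<0 sparse = ⊥-elim (<-irrefl refl (≤-<-trans
      (0≤e≤D*x*y⇒0≤D {D} {size Z₁} {size Z₂} {edges Z₁ Z₂} 0<Z₁ 0<Z₂
        (0≤toℚ (edgesBetween G Z₁ Z₂)) sparse)
      (subst (D <_) (*-zeroˡ γ) D<0)))
    sparse⇒largeGoodPair (suc k) {Z₁} {Z₂} {D} 0<Z₁ 0<Z₂ D≤1-τ D<[k+1]γ sparse =
      [ stop , step ]′ (good-or-dense Z₁ Z₂)
      where
      stop : Good Z₁ Z₂ → LargeGoodPair (suc k) (size Z₁) (size Z₂)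
      stop good =
        Z₁ , Z₂ , p^n*q≤q 0<η η≤1 (0≤size Z₁) (suc k) , p^n*q≤q 0<η η≤1 (0≤size Z₂) (suc k) , good
      recurse : ∃₂ (Increment Z₁ Z₂ D) → LargeGoodPair (suc k) (size Z₁) (size Z₂)
      recurse (X₁ , X₂ , ηZ₁≤X₁ , ηZ₂≤X₂ , sparser) = shrink (sparse⇒largeGoodPair k {X₁} {X₂} {D - γ}
        (<-≤-trans (*-pres-0< 0<η 0<Z₁) ηZ₁≤X₁) (<-≤-trans (*-pres-0< 0<η 0<Z₂) ηZ₂≤X₂)
        (≤-trans (p-q≤p (<⇒≤ 0<γ)) D≤1-τ) (p<[1+k]q⇒p-q<kq k D<[k+1]γ) sparser)
        where
        0≤ηᵏ : 0ℚ ≤ η ^ k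
        0≤ηᵏ = <⇒≤ (^-pres-0< 0<η k)
        shrink : LargeGoodPair k (size X₁) (size X₂) → LargeGoodPair (suc k) (size Z₁) (size Z₂)
        shrink (W₁ , W₂ , ηᵏX₁≤W₁ , ηᵏX₂≤W₂ , good) =
          W₁ , W₂ , ≤-trans-scaled 0≤ηᵏ ηZ₁≤X₁ ηᵏX₁≤W₁ , ≤-trans-scaled 0≤ηᵏ ηZ₂≤X₂ ηᵏX₂≤W₂ , good
      step : ∃₂ (Dense Z₁ Z₂) → LargeGoodPair (suc k) (size Z₁) (size Z₂)
      step (Y₁ , Y₂ , dense) =
        recurse (density-increment {Z₁} {Z₂} {Y₁} {Y₂} {D} 0<Z₁ 0<Z₂ D≤1-τ sparse dense)

mainTheorem4 : (c ε τ : ℚ) → 0ℚ < c → 0ℚ < ε → 0ℚ < τ → ε < τ → τ ≤ + 8 / 9 →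
    Σ ℚ λ δ → 0ℚ < δ ×
      ((G : Bigraph) → 0 <ℕ n₁ G → 0 <ℕ n₂ G →
        toℚ (edgeCount G) ≤ (1ℚ - τ) * toℚ (n₁ G) * toℚ (n₂ G) →
        Σ (Subset (n₁ G)) λ Z₁ → Σ (Subset (n₂ G)) λ Z₂ →
          δ * toℚ (n₁ G) ≤ toℚ ∣ Z₁ ∣ × δ * toℚ (n₂ G) ≤ toℚ ∣ Z₂ ∣ ×
          ((Y₁ : Subset (n₁ G)) (Y₂ : Subset (n₂ G)) → Y₁ ⊆ Z₁ → Y₂ ⊆ Z₂ →
            c * toℚ ∣ Z₁ ∣ ≤ toℚ ∣ Y₁ ∣ → c * toℚ ∣ Z₂ ∣ ≤ toℚ ∣ Y₂ ∣ →
            toℚ (edgesBetween G Y₁ Y₂) < (1ℚ - ε) * toℚ ∣ Y₁ ∣ * toℚ ∣ Y₂ ∣))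
mainTheorem4 c ε τ 0<c _ 0<τ ε<τ _ = η ^ K , ^-pres-0< 0<η K , λ G 0<n₁ 0<n₂ sparse →
  subst₂ (LargeGoodPair G K) (size-⊤ (n₁ G)) (size-⊤ (n₂ G))
    (sparse⇒largeGoodPair G K {⊤} {⊤} {1ℚ - τ} (0<size-⊤ 0<n₁) (0<size-⊤ 0<n₂) ≤-refl 1-τ<Kγ
      (subst₂ _≤_ (cong toℚ (edgeCount≡edgesBetween-⊤ G))
        (sym (cong₂ (λ N₁ N₂ → (1ℚ - τ) * N₁ * N₂) (size-⊤ (n₁ G)) (size-⊤ (n₂ G)))) sparse))
  where
  open DensityIncrement c ε τ 0<c ε<τ 0<τ
  K : ℕ
  K = proj₁ (archimedean 0<γ)
  1-τ<Kγ : 1ℚ - τ < toℚ K * γ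
  1-τ<Kγ = <-≤-trans (p-q<p 0<τ) (proj₂ (archimedean 0<γ))
  0<size-⊤ : ∀ {n} → 0 <ℕ n → 0ℚ < size (⊤ {n})
  0<size-⊤ {n} 0<n = subst (0ℚ <_) (sym (size-⊤ n)) (toℚ-mono-< 0<n)
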